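{- For every $n\ge 5$, the cycle $C_n$ on $n$ vertices is not a proper max-point-tolerance graph.
   Context: $G=(V,E)$ (finite, simple, undirected) is a max-point-tolerance graph (MPTG) if each vertex $u$ can be assigned a pair $(I_u,p_u)$, with $I_u$ a closed bounded real interval and $p_u\in I_u$, such that for distinct $u,v$, $uv\in E$ iff $\{p_u,p_v\}\subseteq I_u\cap I_v$. It is a proper MPTG if it has such a representation in which no interval properly contains another. -}

module Defs where

open import Level using (Level; _⊔_; suc)
open import Data.Nat using (ℕ; zero) renaming (suc to sucℕ)
open import Data.Fin using (Fin; toℕ)
open import Data.Product using (Σ; _×_; _,_)
open import Data.Sum using (_⊎_)
open import Relation.Nullary using (¬_)
open import Relation.Binary.PropositionalEquality using (_≡_; _≢_)
open import Relation.Binary.Bundles using (TotalOrder)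
open import Function.Bundles using (_⇔_)

Graph : ℕ → Set₁
Graph n = Fin n → Fin n → Set

CycleAdj : (n : ℕ) → Graph n
CycleAdj n u v =
  (toℕ v ≡ sucℕ (toℕ u)) ⊎ (toℕ u ≡ sucℕ (toℕ v))
  ⊎ ((toℕ u ≡ zero × sucℕ (toℕ v) ≡ n) ⊎ (toℕ v ≡ zero × sucℕ (toℕ u) ≡ n))

-- Representations with coordinates in an arbitrary total order O
-- (the paper uses the reals ℝ, which is one such order).
module _ {c ℓ₁ ℓ₂ : Level} (O : TotalOrder c ℓ₁ ℓ₂) where
  open TotalOrder O renaming (Carrier to A)

  record IntPoint : Set (c ⊔ ℓ₂) where
    constructor ⟨_,_,_,_,_⟩
    field
      lo  : A
      hi  : A
      pt  : A
      lo≤pt : lo ≤ pt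
      pt≤hi : pt ≤ hi
  open IntPoint public

  _∈I_ : A → IntPoint → Set ℓ₂
  x ∈I I = (lo I ≤ x) × (x ≤ hi I)

  _⊆I_ : IntPoint → IntPoint → Set (c ⊔ ℓ₂)
  I ⊆I J = ∀ x → x ∈I I → x ∈I J

  _⊊I_ : IntPoint → IntPoint → Set (c ⊔ ℓ₂)
  I ⊊I J = (I ⊆I J) × ¬ (J ⊆I I)

  IsMPTGRep : {n : ℕ} → Graph n → (Fin n → IntPoint) → Set ℓ₂
  IsMPTGRep G r = ∀ u v → u ≢ v →
    G u v ⇔ ((pt (r u) ∈I r u) × (pt (r u) ∈I r v) × (pt (r v) ∈I r u) × (pt (r v) ∈I r v))

  IsProperMPTG : {n : ℕ} → Graph n → Set (c ⊔ ℓ₂)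
  IsProperMPTG {n} G = Σ (Fin n → IntPoint) λ r →
    IsMPTGRep G r × (∀ u v → ¬ (r u ⊊I r v))

-- Let p_a be the least of the points. Its two cycle-neighbours b and c satisfy, say, p_b ≤ p_c;
-- let d be the other neighbour of b. Since n ≥ 5, c a b d is an induced path. Non-adjacency of b and c
-- forces I_b to end before p_c, so the right end of I_d (before p_c, as d ≁ c) lies in I_a, and its
-- left end lies beyond p_a (as d ≁ a). Hence I_d ⊊ I_a, contradicting properness.
module Submission where

open import Defs
open import Level using (Level)
open import Data.Nat using (ℕ; zero; suc; _+_; _≤_; _<_; _≟_)
open import Data.Nat.Properties
  using (+-suc; +-identityʳ; +-comm; +-cancelˡ-≡; +-cancelˡ-<; +-monoʳ-<; m≤m+n; m+n≮m;
         <-irrefl; <-≤-trans; <⇒≤; ≤⇒≯; module ≤-Reasoning)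
open import Data.Nat.GeneralisedArithmetic using (iterate)
open import Data.Fin using (Fin; zero; suc; toℕ; fromℕ; inject₁; lower₁; #_)
open import Data.Fin.Properties using (toℕ-injective; toℕ<n; toℕ-lower₁; toℕ-inject₁; toℕ-fromℕ)
open import Data.List using (allFin)
open import Data.List.Relation.Unary.All as All using ()
open import Data.List.Membership.Propositional.Properties using (∈-allFin)
import Data.List.Extrema as Extrema
open import Data.Product using (Σ; _×_; _,_; proj₁)
open import Data.Sum using (_⊎_; inj₁; inj₂; [_,_])
open import Data.Empty using (⊥; ⊥-elim)
open import Function using (_∘_)
open import Function.Bundles using (Equivalence)
open import Relation.Nullary using (¬_; yes; no)
open import Relation.Binary.Bundles using (TotalOrder)
import Relation.Binary.Properties.TotalOrder as TotalOrderProperties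
open import Relation.Binary.PropositionalEquality
  using (_≡_; _≢_; refl; sym; trans; cong; subst; module ≡-Reasoning)

module _ {c ℓ₁ ℓ₂} (O : TotalOrder c ℓ₁ ℓ₂) where
  open TotalOrder O renaming (Carrier to A; _≤_ to _≼_; trans to ≼-trans)
  open TotalOrderProperties O using (≰⇒≥)

  ∃-minimiser : ∀ {m} (f : Fin (suc m) → A) → Σ (Fin (suc m)) λ a → ∀ v → f a ≼ f v
  ∃-minimiser {m} f = argmin f zero (allFin (suc m))
                    , λ v → All.lookup (f[argmin]≤f[xs] {f = f} zero (allFin (suc m))) (∈-allFin v)
    where open Extrema O

  -- MPTG adjacency, minus the conditions p ∈ I that hold for every interval-point.
  record Linked (I J : IntPoint O) : Set ℓ₂ where
    constructor linked
    field
      pt-left∈right : _∈I_ O (pt I) J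
      pt-right∈left : _∈I_ O (pt J) I

  Linked-sym : ∀ {I J} → Linked I J → Linked J I
  Linked-sym (linked pI∈J pJ∈I) = linked pJ∈I pI∈J

  record InducedP₄ (w x y z : IntPoint O) : Set ℓ₂ where
    field
      w-x : Linked w x
      x-y : Linked x y
      y-z : Linked y z
      w≁y : ¬ Linked w y
      x≁z : ¬ Linked x z
      w≁z : ¬ Linked w z

  InducedP₄-reverse : ∀ {w x y z} → InducedP₄ w x y z → InducedP₄ z y x w
  InducedP₄-reverse P = record
    { w-x = Linked-sym y-z ; x-y = Linked-sym x-y ; y-z = Linked-sym w-x
    ; w≁y = x≁z ∘ Linked-sym ; x≁z = w≁y ∘ Linked-sym ; w≁z = w≁z ∘ Linked-sym }
    where open InducedP₄ P

  InducedP₄-end-⊊ : ∀ {w x y z} → InducedP₄ w x y z →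
    pt x ≼ pt y → pt x ≼ pt z → pt y ≼ pt w → _⊊I_ O z x
  InducedP₄-end-⊊ {w} {x} {y} {z}
    record { w-x = linked (lx≼pw , pw≼hx) (lw≼px , _) ; x-y = linked (ly≼px , _) _
           ; y-z = linked (lz≼py , _) (_ , pz≼hy) ; w≁y = w≁y ; x≁z = x≁z ; w≁z = w≁z }
    px≼py px≼pz py≼pw = z⊆x , λ x⊆z → px≺lz (proj₁ (x⊆z (pt x) (lo≤pt x , pt≤hi x)))
    where

    hy≼pw : hi y ≼ pt w
    hy≼pw = ≰⇒≥ λ pw≼hy → w≁y (linked
      (≼-trans ly≼px (≼-trans px≼py py≼pw) , pw≼hy)
      (≼-trans lw≼px px≼py , ≼-trans py≼pw (pt≤hi w)))

    px≺lz : ¬ (lo z ≼ pt x)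
    px≺lz lz≼px = x≁z (linked
      (lz≼px , ≼-trans px≼pz (pt≤hi z))
      (≼-trans (lo≤pt x) px≼pz , ≼-trans pz≼hy (≼-trans hy≼pw pw≼hx)))

    hz≺pw : ¬ (pt w ≼ hi z)
    hz≺pw pw≼hz = w≁z (linked
      (≼-trans lz≼py py≼pw , pw≼hz)
      (≼-trans lw≼px px≼pz , ≼-trans pz≼hy (≼-trans hy≼pw (pt≤hi w))))

    z⊆x : _⊆I_ O z x
    z⊆x t (lz≼t , t≼hz) = ≼-trans (≼-trans (lo≤pt x) (≰⇒≥ px≺lz)) lz≼t
                        , ≼-trans t≼hz (≼-trans (≰⇒≥ hz≺pw) pw≼hx)

next : ∀ {n} → Fin n → Fin n
next {suc m} u with suc m ≟ toℕ (suc u)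
... | yes _    = zero
... | no ¬last = lower₁ (suc u) ¬last

prev : ∀ {n} → Fin n → Fin n
prev {suc m} zero    = fromℕ m
prev {suc m} (suc u) = inject₁ u

toℕ-next : ∀ {n} (u : Fin n) →
  toℕ (next u) ≡ suc (toℕ u) ⊎ (toℕ (next u) ≡ 0 × suc (toℕ u) ≡ n)
toℕ-next {suc m} u with suc m ≟ toℕ (suc u)
... | yes last = inj₂ (refl , sym last)
... | no ¬last = inj₁ (toℕ-lower₁ (suc u) ¬last)

toℕ-next⁻¹ : ∀ {n} {u v : Fin n} →
  toℕ v ≡ suc (toℕ u) ⊎ (toℕ v ≡ 0 × suc (toℕ u) ≡ n) → v ≡ next u
toℕ-next⁻¹ {u = u} {v} hyp with hyp | toℕ-next u
... | inj₁ v≡ | inj₁ next≡         = toℕ-injective (trans v≡ (sym next≡))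
... | inj₁ v≡ | inj₂ (_ , last)    = ⊥-elim (<-irrefl (trans v≡ last) (toℕ<n v))
... | inj₂ (_ , last) | inj₁ next≡ = ⊥-elim (<-irrefl (trans next≡ last) (toℕ<n (next u)))
... | inj₂ (v≡0 , _) | inj₂ (next≡0 , _) = toℕ-injective (trans v≡0 (sym next≡0))

next-prev : ∀ {n} (v : Fin n) → next (prev v) ≡ v
next-prev {suc m} zero    = sym (toℕ-next⁻¹ (inj₂ (refl , cong suc (toℕ-fromℕ m))))
next-prev {suc m} (suc u) = sym (toℕ-next⁻¹ (inj₁ (cong suc (sym (toℕ-inject₁ u)))))

CycleAdj-next : ∀ {n} (u : Fin n) → CycleAdj n u (next u)
CycleAdj-next u with toℕ-next u
... | inj₁ next≡           = inj₁ next≡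
... | inj₂ (next≡0 , last) = inj₂ (inj₂ (inj₂ (next≡0 , last)))

CycleAdj⇒next : ∀ {n} {u v : Fin n} → CycleAdj n u v → v ≡ next u ⊎ u ≡ next v
CycleAdj⇒next (inj₁ v≡)                   = inj₁ (toℕ-next⁻¹ (inj₁ v≡))
CycleAdj⇒next (inj₂ (inj₁ u≡))            = inj₂ (toℕ-next⁻¹ (inj₁ u≡))
CycleAdj⇒next (inj₂ (inj₂ (inj₁ wrap)))   = inj₂ (toℕ-next⁻¹ (inj₂ wrap))
CycleAdj⇒next (inj₂ (inj₂ (inj₂ wrap)))   = inj₁ (toℕ-next⁻¹ (inj₂ wrap))

toℕ-iterate-next : ∀ {n} j (s : Fin n) → j < n →
  toℕ s + j ≡ toℕ (iterate next s j) ⊎ toℕ s + j ≡ n + toℕ (iterate next s j)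
toℕ-iterate-next zero    s _ = inj₁ (+-identityʳ (toℕ s))
toℕ-iterate-next {n} (suc j) s 1+j<n with toℕ-next s | toℕ-iterate-next j (next s) (<⇒≤ 1+j<n)
... | inj₁ next≡ | inj₁ ih = inj₁ (trans (+-suc (toℕ s) j) (trans (cong (_+ j) (sym next≡)) ih))
... | inj₁ next≡ | inj₂ ih = inj₂ (trans (+-suc (toℕ s) j) (trans (cong (_+ j) (sym next≡)) ih))
... | inj₂ (next≡0 , last) | inj₁ ih = inj₂ (begin
  toℕ s + suc j                    ≡⟨ +-suc (toℕ s) j ⟩
  suc (toℕ s) + j                  ≡⟨ cong (_+ j) last ⟩
  n + j                            ≡⟨ cong (λ k → n + (k + j)) (sym next≡0) ⟩
  n + (toℕ (next s) + j)           ≡⟨ cong (n +_) ih ⟩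
  n + toℕ (iterate next s (suc j)) ∎)
  where open ≡-Reasoning
... | inj₂ (next≡0 , _) | inj₂ ih =
  ⊥-elim (m+n≮m n _ (subst (_< n) (trans (cong (_+ j) (sym next≡0)) ih) (<⇒≤ 1+j<n)))

unwrapped-wrapped-⊥ : ∀ {n a t i j} → a + i ≡ t → j < n → a + j ≡ n + t → ⊥
unwrapped-wrapped-⊥ {n} {a} {t} {i} {j} a+i≡t j<n a+j≡n+t =
  ≤⇒≯ (subst (a ≤_) a+i≡t (m≤m+n a i)) (+-cancelˡ-< n t a (begin-strict
    n + t  ≡⟨ sym a+j≡n+t ⟩
    a + j  <⟨ +-monoʳ-< a j<n ⟩
    a + n  ≡⟨ +-comm a n ⟩
    n + a  ∎))
  where open ≤-Reasoning

offset-unique : ∀ {n a t i j} → i < n → j < n →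
  a + i ≡ t ⊎ a + i ≡ n + t → a + j ≡ t ⊎ a + j ≡ n + t → i ≡ j
offset-unique {a = a} _ _ (inj₁ a+i≡t) (inj₁ a+j≡t) = +-cancelˡ-≡ a _ _ (trans a+i≡t (sym a+j≡t))
offset-unique _ j<n (inj₁ a+i≡t) (inj₂ a+j≡n+t) = ⊥-elim (unwrapped-wrapped-⊥ a+i≡t j<n a+j≡n+t)
offset-unique i<n _ (inj₂ a+i≡n+t) (inj₁ a+j≡t) = ⊥-elim (unwrapped-wrapped-⊥ a+j≡t i<n a+i≡n+t)
offset-unique {a = a} _ _ (inj₂ a+i≡n+t) (inj₂ a+j≡n+t) = +-cancelˡ-≡ a _ _ (trans a+i≡n+t (sym a+j≡n+t))

iterate-next-injective : ∀ {n} (s : Fin n) {i j} → i < n → j < n →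
  iterate next s i ≡ iterate next s j → i ≡ j
iterate-next-injective s {i} {j} i<n j<n eq = offset-unique i<n j<n
  (toℕ-iterate-next i s i<n)
  (subst (λ v → _ ≡ toℕ v ⊎ _ ≡ _ + toℕ v) (sym eq) (toℕ-iterate-next j s j<n))

module _ {c ℓ₁ ℓ₂} (O : TotalOrder c ℓ₁ ℓ₂) {n} {G : Graph n} (r : Fin n → IntPoint O)
         (rep : IsMPTGRep O G r) where

  adjacent⇒Linked : ∀ {u v} → u ≢ v → G u v → Linked O (r u) (r v)
  adjacent⇒Linked u≢v uv with Equivalence.to (rep _ _ u≢v) uv
  ... | _ , pu∈v , pv∈u , _ = linked pu∈v pv∈u

  nonadjacent⇒¬Linked : ∀ {u v} → u ≢ v → ¬ G u v → ¬ Linked O (r u) (r v)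
  nonadjacent⇒¬Linked {u} {v} u≢v ¬uv (linked pu∈v pv∈u) = ¬uv (Equivalence.from (rep u v u≢v)
    ((lo≤pt (r u) , pt≤hi (r u)) , pu∈v , pv∈u , (lo≤pt (r v) , pt≤hi (r v))))

cycle-InducedP₄ : ∀ {c ℓ₁ ℓ₂} (O : TotalOrder c ℓ₁ ℓ₂) {n} (r : Fin n → IntPoint O) →
  IsMPTGRep O (CycleAdj n) r → 5 ≤ n → ∀ {w x y z} →
  next w ≡ x → next x ≡ y → next y ≡ z → InducedP₄ O (r w) (r x) (r y) (r z)
cycle-InducedP₄ O {n} r rep 5≤n {w} refl refl refl = record
  { w-x = edge (distinct (# 0) (# 1) λ ())
  ; x-y = edge (distinct (# 1) (# 2) λ ())
  ; y-z = edge (distinct (# 2) (# 3) λ ())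
  ; w≁y = non-edge (distinct (# 0) (# 2) λ ()) (distinct (# 2) (# 1) λ ()) (distinct (# 0) (# 3) λ ())
  ; x≁z = non-edge (distinct (# 1) (# 3) λ ()) (distinct (# 3) (# 2) λ ()) (distinct (# 1) (# 4) λ ())
  ; w≁z = non-edge (distinct (# 0) (# 3) λ ()) (distinct (# 3) (# 1) λ ()) (distinct (# 0) (# 4) λ ())
  }
  where
  -- walk 0 ≢ walk 4, needed for w ≁ z, is where 5 ≤ n enters.
  walk : Fin 5 → Fin n
  walk i = iterate next w (toℕ i)

  distinct : ∀ i j → i ≢ j → walk i ≢ walk j
  distinct i j i≢j = i≢j ∘ toℕ-injective
    ∘ iterate-next-injective w (<-≤-trans (toℕ<n i) 5≤n) (<-≤-trans (toℕ<n j) 5≤n)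

  edge : ∀ {u} → u ≢ next u → Linked O (r u) (r (next u))
  edge {u} u≢next = adjacent⇒Linked O r rep u≢next (CycleAdj-next u)

  non-edge : ∀ {u v} → u ≢ v → v ≢ next u → u ≢ next v → ¬ Linked O (r u) (r v)
  non-edge u≢v v≢next u≢next = nonadjacent⇒¬Linked O r rep u≢v ([ v≢next , u≢next ] ∘ CycleAdj⇒next)

lemma3p7 : ∀ {c ℓ₁ ℓ₂ : Level} (O : TotalOrder c ℓ₁ ℓ₂) (n : ℕ) → 5 ≤ n →
    ¬ IsProperMPTG O (CycleAdj n)
lemma3p7 O zero ()
lemma3p7 O (suc m) 5≤n (r , rep , proper) with ∃-minimiser O (pt ∘ r)
... | a , min with TotalOrder.total O (pt (r (next a))) (pt (r (prev a)))
... | inj₁ pnext≼pprev = proper (next (next a)) a (InducedP₄-end-⊊ O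
        (cycle-InducedP₄ O r rep 5≤n (next-prev a) refl refl)
        (min _) (min _) pnext≼pprev)
... | inj₂ pprev≼pnext = proper (prev (prev a)) a (InducedP₄-end-⊊ O
        (InducedP₄-reverse O (cycle-InducedP₄ O r rep 5≤n (next-prev (prev a)) (next-prev a) refl))
        (min _) (min _) pprev≼pnext)
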